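{- Let $H=(V,E)$ be a non-separable hypergraph with at least two edges of cardinality greater than $1$. Let $G=\mathcal{G}(H)$ be its incidence graph and $x$ a cut vertex of $G$. Then $x\in E$ and $x$ is a weak cut edge of $H$.
   Context: A hypergraph $H=(V,E)$ consists of a nonempty finite vertex set $V$, a finite edge set $E$, and an incidence function $\psi:E\to 2^V$; edges are identified with their vertex sets (parallel edges allowed). Two distinct vertices are adjacent via $e$ if both lie in $e$; a walk is a sequence $v_0e_1v_1\dots e_kv_k$ with $v_{i-1},v_i$ adjacent via $e_i$; $H$ is connected if any two distinct vertices are joined by a walk. For an equivalence class $V'$ of "joined by a walk", the connected component is $(V',\{f\in E:\emptyset\ne f\subseteq V'\})$; $\omega(H)$ is the number of components. $H-e=(V,E\setminus\{e\})$; $e$ is a cut edge if $\omega(H-e)>\omega(H)$; a cut edge is strong if $\omega(H-e)=\omega(H)+|e|-1$ and weak otherwise. A hypersubgraph is $(V',E')$ with $V'\subseteq V$, $E'\subseteq E$. A vertex $v$ is a separating vertex of $H$ if there are two connected hypersubgraphs $H_1,H_2$, each with at least one edge, with $E(H_1)\cap E(H_2)=\emptyset$, $V=V(H_1)\cup V(H_2)$, $E=E(H_1)\cup E(H_2)$, and $V(H_1)\cap V(H_2)=\{v\}$. $H$ is non-separable if it is connected, has no empty edges and no separating vertices. The incidence graph $\mathcal{G}(H)$ is the bipartite graph with vertex set $V\cup E$ and edge set $\{ve:v\in e\}$; a cut vertex of a graph is a vertex whose deletion increases the number of connected components. -}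

module Defs where

open import Data.Nat using (ℕ; _<_; _≤_; _∸_; _+_)
open import Data.Fin using (Fin)
open import Data.Fin.Subset using (Subset; _∈_; _∉_; _⊆_; ⊤; ∣_∣; _-_)
open import Data.Sum using (_⊎_; inj₁; inj₂)
open import Data.Product using (Σ; ∃; _×_; _,_)
open import Data.Unit using () renaming (⊤ to 𝟙)
open import Data.Empty using (⊥)
open import Relation.Nullary using (¬_)
open import Relation.Binary.PropositionalEquality using (_≡_; _≢_)

data Path {A : Set} (R : A → A → Set) (P : A → Set) : A → A → Set where
  nil  : ∀ {a} → Path R P a a
  cons : ∀ {a b c} → R a b → P b → Path R P b c → Path R P a c

-- NumComponents R P k : the vertices satisfying P fall into exactly k
-- classes of "joined by a walk": rep i (i : Fin k) is a system of
-- representatives, one for each class.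
NumComponents : {A : Set} (R : A → A → Set) (P : A → Set) → ℕ → Set
NumComponents {A} R P k =
  Σ (Fin k → A) λ rep →
    (∀ i → P (rep i)) ×
    (∀ i j → Path R P (rep i) (rep j) → i ≡ j) ×
    (∀ a → P a → ∃ λ i → Path R P a (rep i))

-- Hypergraphs: V = Fin nv (nonempty), E = Fin ne, incidence ψ.
-- Parallel edges are allowed (ψ need not be injective).

record Hypergraph : Set where
  field
    nv : ℕ
    ne : ℕ
    V-nonempty : 1 ≤ nv
    ψ : Fin ne → Subset nv
open Hypergraph public

Adj : (H : Hypergraph) → Subset (ne H) → Fin (nv H) → Fin (nv H) → Set
Adj H ES u w = ∃ λ e → e ∈ ES × u ∈ ψ H e × w ∈ ψ H e × u ≢ w

AllV : {A : Set} → A → Set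
AllV _ = 𝟙

Walk : (H : Hypergraph) → Subset (ne H) → Fin (nv H) → Fin (nv H) → Set
Walk H ES = Path (Adj H ES) AllV

Connected : Hypergraph → Set
Connected H = ∀ u w → u ≢ w → Walk H ⊤ u w

ω≡ : (H : Hypergraph) → Subset (ne H) → ℕ → Set
ω≡ H ES k = NumComponents (Adj H ES) AllV k

minusEdge : (H : Hypergraph) → Fin (ne H) → Subset (ne H)
minusEdge H e = ⊤ - e

CutEdge : (H : Hypergraph) → Fin (ne H) → Set
CutEdge H e = ∃ λ k → ∃ λ k' → ω≡ H ⊤ k × ω≡ H (minusEdge H e) k' × k < k'

StrongCutEdge : (H : Hypergraph) → Fin (ne H) → Set
StrongCutEdge H e = ∃ λ k → ∃ λ k' → ω≡ H ⊤ k × ω≡ H (minusEdge H e) k' ×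
                    k < k' × k' ≡ k + ∣ ψ H e ∣ ∸ 1

WeakCutEdge : (H : Hypergraph) → Fin (ne H) → Set
WeakCutEdge H e = CutEdge H e × ¬ StrongCutEdge H e

IsHypersubgraph : (H : Hypergraph) → Subset (nv H) → Subset (ne H) → Set
IsHypersubgraph H V1 E1 = ∀ e → e ∈ E1 → ψ H e ⊆ V1

ConnectedSub : (H : Hypergraph) → Subset (nv H) → Subset (ne H) → Set
ConnectedSub H V1 E1 =
  ∀ u w → u ∈ V1 → w ∈ V1 → u ≢ w → Path (Adj H E1) (_∈ V1) u w

SeparatingVertex : (H : Hypergraph) → Fin (nv H) → Set
SeparatingVertex H v =
  Σ (Subset (nv H)) λ V1 → Σ (Subset (nv H)) λ V2 →
  Σ (Subset (ne H)) λ E1 → Σ (Subset (ne H)) λ E2 →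
    IsHypersubgraph H V1 E1 × IsHypersubgraph H V2 E2 ×
    ConnectedSub H V1 E1 × ConnectedSub H V2 E2 ×
    (∃ λ e → e ∈ E1) × (∃ λ e → e ∈ E2) ×
    (∀ e → e ∈ E1 → e ∈ E2 → ⊥) ×
    (∀ u → u ∈ V1 ⊎ u ∈ V2) ×
    (∀ e → e ∈ E1 ⊎ e ∈ E2) ×
    v ∈ V1 × v ∈ V2 × (∀ u → u ∈ V1 → u ∈ V2 → u ≡ v)

NonSeparable : Hypergraph → Set
NonSeparable H =
  Connected H ×
  (∀ e → ∃ λ v → v ∈ ψ H e) ×
  (∀ v → ¬ SeparatingVertex H v)

IVert : Hypergraph → Set
IVert H = Fin (nv H) ⊎ Fin (ne H)

IAdj : (H : Hypergraph) → IVert H → IVert H → Set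
IAdj H (inj₁ v) (inj₂ e) = v ∈ ψ H e
IAdj H (inj₂ e) (inj₁ v) = v ∈ ψ H e
IAdj H (inj₁ _) (inj₁ _) = ⊥
IAdj H (inj₂ _) (inj₂ _) = ⊥

IncidenceCutVertex : (H : Hypergraph) → IVert H → Set
IncidenceCutVertex H x =
  ∃ λ k → ∃ λ k' →
    NumComponents (IAdj H) AllV k ×
    NumComponents (IAdj H) (λ y → y ≢ x) k' × k < k'

-- Removing a vertex v of H from 𝒢(H) leaves at
-- least two components, and colouring the edges of H by "lies in the first
-- component" splits H into two connected pieces meeting only in v, so v would
-- separate H. Hence x is an edge e, and since H is connected, e is a cut edge.
-- Every component of H − e meets e, so if e were strong, H − e would have
-- exactly |e| components, each containing exactly one vertex of e. Colouring
-- the edges other than e by "lies in the component of the vertex u of e" then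
-- exhibits u as a separating vertex, using a second edge to make that colour
-- class nonempty.
module Submission where

open import Defs
open import Data.Nat using (ℕ; zero; suc; _<_; _≤_; z≤n; s≤s)
open import Data.Nat.Properties using (≤-antisym; ≤-<-trans; <-irrefl; <⇒≱)
open import Data.Fin using (Fin; zero; suc; punchIn; punchOut; fromℕ<) renaming (_≟_ to _≟ᶠ_)
open import Data.Fin.Properties
  using (0≢1+n; injective⇒≤; punchInᵢ≢i; punchOut-punchIn; punchOut-cong; all?)
open import Data.Fin.Subset using (Subset; _∈_; _∉_; ∣_∣; inside; outside; _-_; ⊤)
open import Data.Fin.Subset.Properties
  using (drop-there; x∈p⇒∣p-x∣<∣p∣; x∈p∧x≢y⇒x∈p-y; ∈⊤; _∈?_)
open import Data.Vec using (_∷_; []; tabulate; there)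
open import Data.Vec.Properties using (lookup⇒[]=; []=⇒lookup; lookup∘tabulate)
open import Data.Sum using (_⊎_; inj₁; inj₂)
open import Data.Sum.Properties using (inj₁-injective; inj₂-injective)
open import Data.Product using (∃; _×_; _,_; proj₁; proj₂; uncurry)
open import Data.Unit using (tt)
open import Data.Empty using (⊥; ⊥-elim)
open import Function using (_∘_)
open import Relation.Binary.Definitions using (Symmetric; DecidableEquality)
open import Relation.Binary.PropositionalEquality
  using (_≡_; _≢_; refl; sym; trans; cong; subst)
open import Relation.Nullary using (¬_; yes; no; does)
open import Relation.Nullary.Decidable
  using (dec-true; _⊎-dec_; _×-dec_; _→-dec_; ¬?; decidable-stable)
open import Relation.Unary using (Decidable)

module _ {A : Set} {R : A → A → Set} {P : A → Set} where

  infixr 5 _++ₚ_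
  _++ₚ_ : ∀ {a b c} → Path R P a b → Path R P b c → Path R P a c
  nil        ++ₚ t = t
  cons r p s ++ₚ t = cons r p (s ++ₚ t)

  reverseₚ : Symmetric R → ∀ {a c} → P a → Path R P a c → Path R P c a
  reverseₚ R-sym pa nil           = nil
  reverseₚ R-sym pa (cons r pb s) = reverseₚ R-sym pb s ++ₚ cons (R-sym r) pa nil

module Components {A : Set} {R : A → A → Set} {P : A → Set} (R-sym : Symmetric R)
                  {k : ℕ} (nc : NumComponents R P k) where

  rep : Fin k → A
  rep = proj₁ nc

  rep-P : ∀ i → P (rep i)
  rep-P = proj₁ (proj₂ nc)

  rep-separated : ∀ i j → Path R P (rep i) (rep j) → i ≡ j
  rep-separated = proj₁ (proj₂ (proj₂ nc))

  path-to-rep : ∀ a → P a → ∃ λ i → Path R P a (rep i)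
  path-to-rep = proj₂ (proj₂ (proj₂ nc))

  component : ∀ {a} → P a → Fin k
  component {a} pa = proj₁ (path-to-rep a pa)

  component-path : ∀ {a b} (pa : P a) (pb : P b) → Path R P a b →
                   component pa ≡ component pb
  component-path {a} {b} pa pb s = rep-separated _ _
    (reverseₚ R-sym pa (proj₂ (path-to-rep a pa)) ++ₚ s ++ₚ proj₂ (path-to-rep b pb))

  component-rep : ∀ i → component (rep-P i) ≡ i
  component-rep i = sym (rep-separated _ _ (proj₂ (path-to-rep (rep i) (rep-P i))))

  same-component⇒path : ∀ {a b} (pa : P a) (pb : P b) → component pa ≡ component pb →
                        Path R P a b
  same-component⇒path {a} {b} pa pb eq = proj₂ (path-to-rep a pa) ++ₚ
    subst (λ i → Path R P (rep i) b) (sym eq) (reverseₚ R-sym pb (proj₂ (path-to-rep b pb)))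

module _ {A : Set} {R : A → A → Set} {P : A → Set} (R-sym : Symmetric R) where

  NumComponents-≤ : ∀ {k l} → NumComponents R P k → NumComponents R P l → k ≤ l
  NumComponents-≤ nc₁ nc₂ = injective⇒≤ injective
    where
    module C₁ = Components R-sym nc₁
    module C₂ = Components R-sym nc₂
    injective : ∀ {i j} → C₂.component (C₁.rep-P i) ≡ C₂.component (C₁.rep-P j) → i ≡ j
    injective {i} {j} eq = C₁.rep-separated i j (C₂.same-component⇒path _ _ eq)

  NumComponents-unique : ∀ {k l} → NumComponents R P k → NumComponents R P l → k ≡ l
  NumComponents-unique nc₁ nc₂ = ≤-antisym (NumComponents-≤ nc₁ nc₂) (NumComponents-≤ nc₂ nc₁)

NumComponents-pos : ∀ {A : Set} {R : A → A → Set} {P : A → Set} {k a} →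
                    NumComponents R P k → P a → 1 ≤ k
NumComponents-pos {k = suc _} _ _ = s≤s z≤n
NumComponents-pos {k = zero} {a} (_ , _ , _ , path-to-rep) pa with path-to-rep a pa
... | () , _

Onto : ∀ {n m} → Subset n → (Fin n → Fin m) → Set
Onto S g = ∀ j → ∃ λ p → p ∈ S × g p ≡ j

-- Only the restriction of squash j to the complement of j matters: there it is
-- the bijection punchOut onto Fin (suc m).
squash : ∀ {m} → Fin (suc (suc m)) → Fin (suc (suc m)) → Fin (suc m)
squash j i with j ≟ᶠ i
... | yes _   = zero
... | no j≢i = punchOut j≢i

squash-punchIn : ∀ {m} (j : Fin (suc (suc m))) (i : Fin (suc m)) → squash j (punchIn j i) ≡ i
squash-punchIn j i with j ≟ᶠ punchIn j i
... | yes eq = ⊥-elim (punchInᵢ≢i j i (sym eq))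
... | no _   = trans (punchOut-cong j refl) (punchOut-punchIn j)

onto⇒≤∣∣ : ∀ {n m} (S : Subset n) (g : Fin n → Fin m) → Onto S g → m ≤ ∣ S ∣
onto⇒≤∣∣ {m = zero} S g onto = z≤n
onto⇒≤∣∣ {m = suc m} [] g onto with onto zero
... | () , _
onto⇒≤∣∣ {m = suc m} (outside ∷ S) g onto = onto⇒≤∣∣ S (g ∘ suc) onto-tail
  where
  onto-tail : Onto S (g ∘ suc)
  onto-tail j with onto j
  ... | zero  , () , _
  ... | suc p , p∈ , eq = p , drop-there p∈ , eq
onto⇒≤∣∣ {m = suc zero} (inside ∷ S) g onto = s≤s z≤n
onto⇒≤∣∣ {m = suc (suc m)} (inside ∷ S) g onto =
  s≤s (onto⇒≤∣∣ S (squash (g zero) ∘ g ∘ suc) onto-tail)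
  where
  onto-tail : Onto S (squash (g zero) ∘ g ∘ suc)
  onto-tail j with onto (punchIn (g zero) j)
  ... | zero  , _ , eq  = ⊥-elim (punchInᵢ≢i (g zero) j (sym eq))
  ... | suc p , p∈ , eq =
    p , drop-there p∈ , trans (cong (squash (g zero)) eq) (squash-punchIn (g zero) j)

onto-collision⇒<∣∣ : ∀ {n m} (S : Subset n) (g : Fin n → Fin m) → Onto S g →
                     ∀ {p q} → p ∈ S → q ∈ S → p ≢ q → g p ≡ g q → m < ∣ S ∣
onto-collision⇒<∣∣ S g onto {p} {q} p∈S q∈S p≢q gp≡gq =
  ≤-<-trans (onto⇒≤∣∣ (S - q) g onto-without-q) (x∈p⇒∣p-x∣<∣p∣ q∈S)
  where
  onto-without-q : Onto (S - q) g
  onto-without-q j with onto j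
  ... | r , r∈S , eq with r ≟ᶠ q
  ...   | yes refl = p , x∈p∧x≢y⇒x∈p-y p∈S p≢q , trans gp≡gq eq
  ...   | no r≢q   = r , x∈p∧x≢y⇒x∈p-y r∈S r≢q , eq

onto-∣∣⇒injective : ∀ {n m} (S : Subset n) (g : Fin n → Fin m) → Onto S g → m ≡ ∣ S ∣ →
                    ∀ {p q} → p ∈ S → q ∈ S → g p ≡ g q → p ≡ q
onto-∣∣⇒injective S g onto m≡∣S∣ {p} {q} p∈S q∈S gp≡gq with p ≟ᶠ q
... | yes p≡q = p≡q
... | no p≢q  = ⊥-elim (<-irrefl m≡∣S∣ (onto-collision⇒<∣∣ S g onto p∈S q∈S p≢q gp≡gq))

module _ {n : ℕ} {Q : Fin n → Set} (Q? : Decidable Q) where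

  filter : Subset n
  filter = tabulate (does ∘ Q?)

  ∈-filter⁺ : ∀ {i} → Q i → i ∈ filter
  ∈-filter⁺ {i} q = lookup⇒[]= i filter (trans (lookup∘tabulate _ i) (dec-true (Q? i) q))

  ∈-filter⁻ : ∀ {i} → i ∈ filter → Q i
  ∈-filter⁻ {i} i∈ with Q? i | trans (sym (lookup∘tabulate (does ∘ Q?) i)) ([]=⇒lookup i∈)
  ... | yes q | _ = q
  ... | no _  | ()

x∉p-x : ∀ {n} (p : Subset n) x → x ∉ p - x
x∉p-x (_ ∷ p) zero    ()
x∉p-x (_ ∷ p) (suc x) (there x∈) = x∉p-x p x x∈

module _ (H : Hypergraph) where

  IAdj-sym : Symmetric (IAdj H)
  IAdj-sym {inj₁ _} {inj₂ _} r = r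
  IAdj-sym {inj₂ _} {inj₁ _} r = r

  Adj-sym : ∀ {ES} → Symmetric (Adj H ES)
  Adj-sym (g , g∈ES , u∈g , w∈g , u≢w) = g , g∈ES , w∈g , u∈g , u≢w ∘ sym

  walk⇒incidencePath : ∀ {ES} {P : IVert H → Set} →
    (∀ {g} → g ∈ ES → P (inj₂ g)) → (∀ {w} → P (inj₁ w)) →
    ∀ {u w} → Walk H ES u w → Path (IAdj H) P (inj₁ u) (inj₁ w)
  walk⇒incidencePath Pᴱ Pⱽ nil = nil
  walk⇒incidencePath Pᴱ Pⱽ (cons (g , g∈ES , u∈g , w∈g , _) _ s) =
    cons u∈g (Pᴱ g∈ES) (cons w∈g Pⱽ (walk⇒incidencePath Pᴱ Pⱽ s))

  incidencePath⇒walk : ∀ {ES} {P : IVert H → Set} → (∀ {g} → P (inj₂ g) → g ∈ ES) →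
    ∀ {u w} → Path (IAdj H) P (inj₁ u) (inj₁ w) → Walk H ES u w
  incidencePath⇒walk Pᴱ nil = nil
  incidencePath⇒walk Pᴱ (cons {b = inj₂ g} u∈g pg (cons {b = inj₂ _} () _ _))
  incidencePath⇒walk Pᴱ {u} (cons {b = inj₂ g} u∈g pg (cons {b = inj₁ w} w∈g _ s))
    with u ≟ᶠ w
  ... | yes refl = incidencePath⇒walk Pᴱ s
  ... | no u≢w   = cons (g , Pᴱ pg , u∈g , w∈g , u≢w) tt (incidencePath⇒walk Pᴱ s)

  some-vertex : Fin (nv H)
  some-vertex = fromℕ< (V-nonempty H)

  ω𝒢-pos : ∀ {k} → NumComponents (IAdj H) AllV k → 1 ≤ k
  ω𝒢-pos nc = NumComponents-pos {a = inj₁ some-vertex} nc tt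

  module _ (conn : Connected H) where

    walk : ∀ u w → Walk H ⊤ u w
    walk u w with u ≟ᶠ w
    ... | yes refl = nil
    ... | no u≢w   = conn u w u≢w

    incident-edge : ∀ {u v} → u ≢ v → ∃ λ g → u ∈ ψ H g
    incident-edge {u} {v} u≢v with conn u v u≢v
    ... | nil                          = ⊥-elim (u≢v refl)
    ... | cons (g , _ , u∈g , _) _ _ = g , u∈g

    ω-connected : ω≡ H ⊤ 1
    ω-connected = (λ _ → some-vertex) , (λ _ → tt) , (λ { zero zero _ → refl }) ,
                  λ a _ → zero , walk a some-vertex

  connectedSub-via : ∀ {VS ES} v → v ∈ VS →
    (∀ w → w ∈ VS → w ≢ v → Path (Adj H ES) (_∈ VS) w v) → ConnectedSub H VS ES
  connectedSub-via v v∈ to-v u w u∈ w∈ u≢w with u ≟ᶠ v | w ≟ᶠ v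
  ... | yes refl | yes refl = ⊥-elim (u≢w refl)
  ... | yes refl | no w≢v   = reverseₚ Adj-sym w∈ (to-v w w∈ w≢v)
  ... | no u≢v   | yes refl = to-v u u∈ u≢v
  ... | no u≢v   | no w≢v   = to-v u u∈ u≢v ++ₚ reverseₚ Adj-sym w∈ (to-v w w∈ w≢v)

  ∈minusEdge : ∀ {e g} → g ≢ e → g ∈ minusEdge H e
  ∈minusEdge g≢e = x∈p∧x≢y⇒x∈p-y ∈⊤ g≢e

  ∈minusEdge⇒≢ : ∀ {e g} → g ∈ minusEdge H e → g ≢ e
  ∈minusEdge⇒≢ {e} g∈ refl = x∉p-x ⊤ e g∈

  walk-until-edge : ∀ e {w t} → Walk H ⊤ w t → t ∈ ψ H e →
                    ∃ λ u → u ∈ ψ H e × Walk H (minusEdge H e) w u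
  walk-until-edge e nil t∈e = _ , t∈e , nil
  walk-until-edge e {w} (cons (g , _ , w∈g , w′∈g , w≢w′) _ s) t∈e with g ≟ᶠ e
  ... | yes refl = w , w∈g , nil
  ... | no g≢e with walk-until-edge e s t∈e
  ...   | u , u∈e , s′ = u , u∈e , cons (g , ∈minusEdge g≢e , w∈g , w′∈g , w≢w′) tt s′

module EdgeSplit (H : Hypergraph) (conn : Connected H) (v : Fin (nv H))
                 {Inner : Fin (ne H) → Set} (Inner? : Decidable Inner)
                 (meet-at-v : ∀ {w g h} → w ∈ ψ H g → w ∈ ψ H h → Inner g → ¬ Inner h → w ≡ v)
                 where

  -- A vertex other than v joins the side of the edges through it; meet-at-v makes
  -- this well defined, and connectivity puts every vertex in some edge.
  module Side {T : Fin (ne H) → Set} (T? : Decidable T)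
              (cross-at-v : ∀ {w g h} → w ∈ ψ H g → w ∈ ψ H h → T g → ¬ T h → w ≡ v) where

    OnlyOnSide : Fin (nv H) → Set
    OnlyOnSide w = ∀ g → w ∈ ψ H g → T g

    on-side? : Decidable (λ w → w ≡ v ⊎ OnlyOnSide w)
    on-side? w = (w ≟ᶠ v) ⊎-dec all? (λ g → (w ∈? ψ H g) →-dec T? g)

    vertices : Subset (nv H)
    vertices = filter on-side?

    edges : Subset (ne H)
    edges = filter T?

    v∈vertices : v ∈ vertices
    v∈vertices = ∈-filter⁺ on-side? (inj₁ refl)

    only-on-side : ∀ {g w} → T g → w ∈ ψ H g → w ≢ v → OnlyOnSide w
    only-on-side Tg w∈g w≢v h w∈h with T? h
    ... | yes Th = Th
    ... | no ¬Th = ⊥-elim (w≢v (cross-at-v w∈g w∈h Tg ¬Th))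

    ∈vertices : ∀ {g w} → T g → w ∈ ψ H g → w ∈ vertices
    ∈vertices {w = w} Tg w∈g with w ≟ᶠ v
    ... | yes w≡v = ∈-filter⁺ on-side? (inj₁ w≡v)
    ... | no w≢v  = ∈-filter⁺ on-side? (inj₂ (only-on-side Tg w∈g w≢v))

    ∈vertices⇒only-on-side : ∀ {w} → w ∈ vertices → w ≢ v → OnlyOnSide w
    ∈vertices⇒only-on-side w∈ w≢v with ∈-filter⁻ on-side? w∈
    ... | inj₁ w≡v = ⊥-elim (w≢v w≡v)
    ... | inj₂ only = only

    hypersubgraph : IsHypersubgraph H vertices edges
    hypersubgraph g g∈ w∈g = ∈vertices (∈-filter⁻ T? g∈) w∈g

    -- A walk can only change sides at v, so it stays on this side until it reaches v.
    path-to-v : ∀ {w} → OnlyOnSide w → Walk H ⊤ w v → Path (Adj H edges) (_∈ vertices) w v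
    path-to-v only nil = nil
    path-to-v only (cons {b = w′} (g , _ , w∈g , w′∈g , w≢w′) _ s) =
      cons (g , ∈-filter⁺ T? Tg , w∈g , w′∈g , w≢w′) (∈vertices Tg w′∈g) rest
      where
      Tg : T g
      Tg = only g w∈g
      rest : Path (Adj H edges) (_∈ vertices) w′ v
      rest with w′ ≟ᶠ v
      ... | yes w′≡v = subst (λ x → Path (Adj H edges) (_∈ vertices) x v) (sym w′≡v) nil
      ... | no w′≢v  = path-to-v (only-on-side Tg w′∈g w′≢v) s

    connected : ConnectedSub H vertices edges
    connected = connectedSub-via H v v∈vertices
      λ w w∈ w≢v → path-to-v (∈vertices⇒only-on-side w∈ w≢v) (conn w v w≢v)

  module Inside = Side Inner? meet-at-v
  module Outside = Side {λ g → ¬ Inner g} (¬? ∘ Inner?)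
    (λ w∈g w∈h ¬Ig ¬¬Ih → meet-at-v w∈h w∈g (decidable-stable (Inner? _) ¬¬Ih) ¬Ig)

  separating : (∃ λ g → Inner g) → (∃ λ g → ¬ Inner g) → SeparatingVertex H v
  separating (g₁ , g₁-in) (g₂ , g₂-out) =
    Inside.vertices , Outside.vertices , Inside.edges , Outside.edges ,
    Inside.hypersubgraph , Outside.hypersubgraph , Inside.connected , Outside.connected ,
    (g₁ , ∈-filter⁺ Inner? g₁-in) , (g₂ , ∈-filter⁺ (¬? ∘ Inner?) g₂-out) ,
    (λ g g∈₁ g∈₂ → ∈-filter⁻ (¬? ∘ Inner?) g∈₂ (∈-filter⁻ Inner? g∈₁)) ,
    cover-vertices , cover-edges , Inside.v∈vertices , Outside.v∈vertices , meet-only-at-v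
    where
    cover-vertices : ∀ u → u ∈ Inside.vertices ⊎ u ∈ Outside.vertices
    cover-vertices u with u ≟ᶠ v
    ... | yes refl = inj₁ Inside.v∈vertices
    ... | no u≢v with incident-edge H conn u≢v
    ...   | g , u∈g with Inner? g
    ...     | yes g-in  = inj₁ (Inside.∈vertices g-in u∈g)
    ...     | no g-out = inj₂ (Outside.∈vertices g-out u∈g)

    cover-edges : ∀ g → g ∈ Inside.edges ⊎ g ∈ Outside.edges
    cover-edges g with Inner? g
    ... | yes g-in  = inj₁ (∈-filter⁺ Inner? g-in)
    ... | no g-out = inj₂ (∈-filter⁺ (¬? ∘ Inner?) g-out)

    meet-only-at-v : ∀ u → u ∈ Inside.vertices → u ∈ Outside.vertices → u ≡ v
    meet-only-at-v u u∈₁ u∈₂ with u ≟ᶠ v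
    ... | yes u≡v = u≡v
    ... | no u≢v with incident-edge H conn u≢v
    ...   | g , u∈g = ⊥-elim (Outside.∈vertices⇒only-on-side u∈₂ u≢v g u∈g
                                (Inside.∈vertices⇒only-on-side u∈₁ u≢v g u∈g))

vertex-deletion-connected : (H : Hypergraph) → Connected H → (∀ v → ¬ SeparatingVertex H v) →
  ∀ v {k} → NumComponents (IAdj H) (_≢ inj₁ v) k → k ≤ 1
vertex-deletion-connected H conn nonsep v {zero}        nc = z≤n
vertex-deletion-connected H conn nonsep v {suc zero}    nc = s≤s z≤n
vertex-deletion-connected H conn nonsep v {suc (suc k)} nc =
  ⊥-elim (nonsep v (EdgeSplit.separating H conn v (λ g → label g ≟ᶠ zero) meet-at-v
    (edge-in zero) (let g , g≡1 = edge-in (suc zero) in g , λ g≡0 → 0≢1+n (trans (sym g≡0) g≡1))))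
  where
  open Components (IAdj-sym H) nc

  label : Fin (ne H) → Fin (suc (suc k))
  label g = component {inj₂ g} λ ()

  label-shared : ∀ {w g h} → w ≢ v → w ∈ ψ H g → w ∈ ψ H h → label g ≡ label h
  label-shared w≢v w∈g w∈h =
    component-path _ _ (cons w∈g (w≢v ∘ inj₁-injective) (cons w∈h (λ ()) nil))

  edge-in-component : ∀ y (y≢v : y ≢ inj₁ v) → ∃ λ g → label g ≡ component y≢v
  edge-in-component (inj₂ g) y≢v = g , component-path _ _ nil
  edge-in-component (inj₁ w) y≢v with incident-edge H conn (y≢v ∘ cong inj₁)
  ... | g , w∈g = g , component-path _ _ (cons w∈g y≢v nil)

  edge-in : ∀ i → ∃ λ g → label g ≡ i
  edge-in i with edge-in-component (rep i) (rep-P i)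
  ... | g , eq = g , trans eq (component-rep i)

  meet-at-v : ∀ {w g h} → w ∈ ψ H g → w ∈ ψ H h → label g ≡ zero → label h ≢ zero → w ≡ v
  meet-at-v {w} w∈g w∈h g-in h-out with w ≟ᶠ v
  ... | yes w≡v = w≡v
  ... | no w≢v  = ⊥-elim (h-out (trans (sym (label-shared w≢v w∈g w∈h)) g-in))

module EdgeDeletion (H : Hypergraph) (conn : Connected H) (nonempty : ∀ g → ∃ λ w → w ∈ ψ H g)
                    (e : Fin (ne H)) {k : ℕ} (nc : NumComponents (IAdj H) (_≢ inj₂ e) k) where

  open Components (IAdj-sym H) nc

  pick : Fin (ne H) → Fin (nv H)
  pick g = proj₁ (nonempty g)

  pick∈ : ∀ g → pick g ∈ ψ H g
  pick∈ g = proj₂ (nonempty g)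

  vertex-of : IVert H → Fin (nv H)
  vertex-of (inj₁ w) = w
  vertex-of (inj₂ g) = pick g

  path-to-vertex-of : ∀ y → Path (IAdj H) (_≢ inj₂ e) y (inj₁ (vertex-of y))
  path-to-vertex-of (inj₁ w) = nil
  path-to-vertex-of (inj₂ g) = cons (pick∈ g) (λ ()) nil

  minusEdge-walk⇒path : ∀ {u w} → Walk H (minusEdge H e) u w →
                        Path (IAdj H) (_≢ inj₂ e) (inj₁ u) (inj₁ w)
  minusEdge-walk⇒path = walk⇒incidencePath H (λ g∈ → ∈minusEdge⇒≢ H g∈ ∘ inj₂-injective) (λ ())

  ω-minusEdge : ω≡ H (minusEdge H e) k
  ω-minusEdge = vertex-of ∘ rep , (λ _ → tt) , separated , covered
    where
    separated : ∀ i j → Walk H (minusEdge H e) (vertex-of (rep i)) (vertex-of (rep j)) → i ≡ j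
    separated i j s = rep-separated i j (path-to-vertex-of (rep i) ++ₚ minusEdge-walk⇒path s ++ₚ
                        reverseₚ (IAdj-sym H) (rep-P j) (path-to-vertex-of (rep j)))
    covered : ∀ a → AllV a → ∃ λ i → Walk H (minusEdge H e) a (vertex-of (rep i))
    covered a _ with path-to-rep (inj₁ a) (λ ())
    ... | i , s = i , incidencePath⇒walk H (λ g≢e → ∈minusEdge H (g≢e ∘ cong inj₂))
                                           (s ++ₚ path-to-vertex-of (rep i))

  cut-edge : 1 < k → CutEdge H e
  cut-edge 1<k = 1 , k , ω-connected H conn , ω-minusEdge , 1<k

  label : Fin (nv H) → Fin k
  label w = component {inj₁ w} λ ()

  label-walk : ∀ {u w} → Walk H (minusEdge H e) u w → label u ≡ label w
  label-walk s = component-path _ _ (minusEdge-walk⇒path s)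

  label-edge : ∀ {g u w} → g ≢ e → u ∈ ψ H g → w ∈ ψ H g → label u ≡ label w
  label-edge g≢e u∈g w∈g =
    component-path _ _ (cons u∈g (g≢e ∘ inj₂-injective) (cons w∈g (λ ()) nil))

  label-rep : ∀ i → label (vertex-of (rep i)) ≡ i
  label-rep i = trans (sym (component-path (rep-P i) _ (path-to-vertex-of (rep i))))
                      (component-rep i)

  label-onto-e : Onto (ψ H e) label
  label-onto-e j with walk-until-edge H e (walk H conn (vertex-of (rep j)) (pick e)) (pick∈ e)
  ... | u , u∈e , s = u , u∈e , trans (sym (label-walk s)) (label-rep j)

  -- u is the vertex of e in the component of some edge f ≠ e.
  separable-if-injective : (∀ {p q} → p ∈ ψ H e → q ∈ ψ H e → label p ≡ label q → p ≡ q) →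
                           (∃ λ f → f ≢ e) → ∃ λ u → SeparatingVertex H u
  separable-if-injective injective (f , f≢e) with label-onto-e (label (pick f))
  ... | u , u∈e , u~f = u , EdgeSplit.separating H conn u Inner? meet-at-u
                              (f , f≢e , sym u~f) (e , λ (e≢e , _) → e≢e refl)
    where
    Inner : Fin (ne H) → Set
    Inner g = g ≢ e × label (pick g) ≡ label u

    Inner? : Decidable Inner
    Inner? g = ¬? (g ≟ᶠ e) ×-dec (label (pick g) ≟ᶠ label u)

    inner-label : ∀ {g w} → Inner g → w ∈ ψ H g → label w ≡ label u
    inner-label {g} (g≢e , g-in) w∈g = trans (label-edge g≢e w∈g (pick∈ g)) g-in

    meet-at-u : ∀ {w g h} → w ∈ ψ H g → w ∈ ψ H h → Inner g → ¬ Inner h → w ≡ u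
    meet-at-u {h = h} w∈g w∈h g-in h-out with h ≟ᶠ e
    ... | yes refl = injective w∈h u∈e (inner-label g-in w∈g)
    ... | no h≢e   =
      ⊥-elim (h-out (h≢e , trans (label-edge h≢e (pick∈ h) w∈h) (inner-label g-in w∈g)))

  not-strong : (∀ v → ¬ SeparatingVertex H v) → (∃ λ f → f ≢ e) → ¬ StrongCutEdge H e
  not-strong nonsep other (l , l′ , ω-l , ω-l′ , _ , l′≡l+∣e∣∸1)
    with NumComponents-unique (Adj-sym H) ω-l (ω-connected H conn)
       | NumComponents-unique (Adj-sym H) ω-l′ ω-minusEdge
  ... | refl | refl = uncurry nonsep (separable-if-injective
          (onto-∣∣⇒injective (ψ H e) label label-onto-e l′≡l+∣e∣∸1) other)

other-than : ∀ {A : Set} → DecidableEquality A → {a b : A} → a ≢ b → ∀ c → ∃ λ d → d ≢ c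
other-than _≟_ {a} {b} a≢b c with a ≟ c
... | yes refl = b , a≢b ∘ sym
... | no a≢c   = a , a≢c

theorem3p43 : (H : Hypergraph) → NonSeparable H →
    (∃ λ e₁ → ∃ λ e₂ → e₁ ≢ e₂ × 1 < ∣ ψ H e₁ ∣ × 1 < ∣ ψ H e₂ ∣) →
    (x : IVert H) → IncidenceCutVertex H x →
    ∃ λ e → x ≡ inj₂ e × WeakCutEdge H e
theorem3p43 H (conn , nonempty , nonsep) _ (inj₁ v) (k , k′ , ω𝒢 , ω𝒢-v , k<k′) =
  ⊥-elim (<⇒≱ (≤-<-trans (ω𝒢-pos H ω𝒢) k<k′) (vertex-deletion-connected H conn nonsep v ω𝒢-v))
theorem3p43 H (conn , nonempty , nonsep) (e₁ , e₂ , e₁≢e₂ , _ , _) (inj₂ e)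
            (k , k′ , ω𝒢 , ω𝒢-e , k<k′) =
  e , refl , cut-edge (≤-<-trans (ω𝒢-pos H ω𝒢) k<k′) , not-strong nonsep (other-than _≟ᶠ_ e₁≢e₂ e)
  where
  open EdgeDeletion H conn nonempty e ω𝒢-e
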